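{- Let $m,n\ge 0$ be integers with $m+2n\ge 1$, and let $q\ge 2$ be an integer. If $Z\in\mathcal{Z}_{m,n,q}$, then $Z$ has Property $P_{q-1,1}$.
   Context: A mixed graph $G=(V,E,A)$ consists of a finite vertex set $V$, a set $E$ of edges (unordered pairs of distinct vertices) and a set $A$ of arcs (ordered pairs of distinct vertices), such that any two adjacent vertices are joined by exactly one edge or exactly one arc, not both, and the underlying undirected graph is simple. It is $(m,n)$-coloured if each edge receives one of the colours $1,\dots,m$ and each arc receives one of the colours $1,\dots,n$. Adjacency code: for adjacent vertices $x,y$, the code of $xy$ with respect to $x$ is $c\in\{1,\dots,m+2n\}$ where: $c\in\{1,\dots,m\}$ means $x,y$ are joined by an edge of colour $c$; $c=m+j$ ($1\le j\le n$) means there is an arc of colour $j$ from $x$ to $y$; $c=m+n+j$ ($1\le j\le n$) means there is an arc of colour $j$ from $y$ to $x$. For a vertex $x$ adjacent to every vertex of an ordered set $X=(v_1,\dots,v_\ell)$, let $a_G(x,X)\in\{1,\dots,m+2n\}^\ell$ be the tuple whose $j$-th entry is the code of $xv_j$ with respect to $x$. Property $P_{a,b}$: $G$ has Property $P_{a,b}$ if for every $\ell$ with $0\le\ell\le a$, every set $X=\{v_1,\dots,v_\ell\}$ of $\ell$ pairwise adjacent vertices of $G$, and every $L=(c_1,\dots,c_\ell)\in\{1,\dots,m+2n\}^\ell$, there are at least $b$ vertices $x\in V(G)\setminus X$, adjacent to all of $v_1,\dots,v_\ell$, with $a_G(x,X)=L$. The family $\mathcal{H}_{m+2n,m+2n}$: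 take $K_{m+2n,m+2n}$ with parts $A=\{a_1,\dots,a_{m+2n}\}$, $B=\{b_1,\dots,b_{m+2n}\}$, and a 1-factorization $F_1,\dots,F_{m+2n}$ of it. For $1\le i\le m$ colour each edge of $F_i$ with colour $i$; for $1\le j\le n$ replace each edge of $F_{m+j}$ by an arc of colour $j$ oriented from $A$ to $B$, and each edge of $F_{m+n+j}$ by an arc of colour $j$ oriented from $B$ to $A$. Every such choice gives a member of $\mathcal{H}_{m+2n,m+2n}$. The family $\mathcal{Z}_{m,n,q}$: each member has vertex set consisting of all tuples $(i;v_1,\dots,v_q)$ with $1\le i\le q$, $v_i$ equal to a placeholder symbol "$\cdot$", and $v_j\in\{1,\dots,m+2n\}$ for $j\ne i$ ($i$ is the index of the vertex). Choose $H\in\mathcal{H}_{m+2n,m+2n}$. For vertices $\mathbf v=(i;v_1,\dots,v_q)$ and $\mathbf w=(j;w_1,\dots,w_q)$ with $i<j$, put $s=v_j$, $t=w_i$; then $\mathbf v,\mathbf w$ are joined by an edge of colour $c$ if $a_s,b_t$ are joined in $H$ by an edge of colour $c$; by an arc of colour $c$ from $\mathbf v$ to $\mathbf w$ if $H$ has an arc of colour $c$ from $a_s$ to $b_t$; and by an arc of colour $c$ from $\mathbf w$ to $\mathbf v$ if $H$ has an arc of colour $c$ from $b_t$ to $a_s$. Vertices of equal index are nonadjacent. Each choice of $H$ gives a member $Z\in\mathcal{Z}_{m,n,q}$. -}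

module Defs where

open import Data.Nat using (ℕ; _+_; _≤_; _<_)
open import Data.Fin using (Fin; _≟_; splitAt; join; _<?_)
open import Data.Sum using (_⊎_; inj₁; inj₂)
open import Data.Maybe using (Maybe; just; nothing; is-just; is-nothing; _>>=_)
open import Data.Bool using (Bool; T; _∧_)
open import Data.Bool.Properties using () renaming (_≟_ to _≟ᵇ_)
open import Data.Vec using (Vec; lookup)
open import Data.List.Base using (allFin; map)
open import Data.Bool.ListAction using (and)
open import Data.Product using (Σ; ∃; ∃!; _×_; _,_)
open import Function.Definitions using (Injective)
open import Relation.Binary.PropositionalEquality using (_≡_; _≢_)
open import Relation.Nullary.Decidable using (⌊_⌋; yes; no)

-- Codes {1,…,m+2n} are represented 0-based as Fin (m + (n + n)):
--   first block  Fin m : edge of that colour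
--   second block Fin n : arc of that colour from x to y   (code m+j)
--   third block  Fin n : arc of that colour from y to x   (code m+n+j)

Code : ℕ → ℕ → Set
Code m n = Fin (m + (n + n))

-- code of yx w.r.t. y, given the code of xy w.r.t. x
rev : (m n : ℕ) → Code m n → Code m n
rev m n c with splitAt m c
... | inj₁ e = join m (n + n) (inj₁ e)
... | inj₂ d with splitAt n d
...   | inj₁ o = join m (n + n) (inj₂ (join n n (inj₂ o)))
...   | inj₂ i = join m (n + n) (inj₂ (join n n (inj₁ i)))

-- An (m,n)-coloured mixed graph on vertex type V is given by its adjacency
-- codes: adj x y = nothing iff x,y are nonadjacent, otherwise
-- adj x y = just (code of xy w.r.t. x).  (Consistency: adj x x = nothing and
-- adj y x = map rev (adj x y); Property P below only uses adj.)

Adjacent : ∀ (m n : ℕ) {V : Set} → (V → V → Maybe (Code m n)) → V → V → Set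
Adjacent m n adj x y = T (is-just (adj x y))

IsClique : ∀ (m n : ℕ) {V : Set} → (V → V → Maybe (Code m n)) → {ℓ : ℕ} → (Fin ℓ → V) → Set
IsClique m n adj X = Injective _≡_ _≡_ X × (∀ i j → i ≢ j → Adjacent m n adj (X i) (X j))

Property-P : ∀ (m n : ℕ) (V : Set) (adj : V → V → Maybe (Code m n)) (a b : ℕ) → Set
Property-P m n V adj a b =
  ∀ (ℓ : ℕ) → ℓ ≤ a →
  ∀ (X : Fin ℓ → V) → IsClique m n adj X →
  ∀ (L : Fin ℓ → Code m n) →
  Σ (Fin b → V) λ xs →
    Injective _≡_ _≡_ xs ×
    (∀ r → (∀ i → xs r ≢ X i) ×
           (∀ i → adj (xs r) (X i) ≡ just (L i)))

-- The family H_{m+2n,m+2n}.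
-- Parts A = {a_s}, B = {b_t}, indexed by Fin (m+2n).  The 1-factorization
-- F_1,…,F_{m+2n} is given by  f s t = the index of the factor containing a_s b_t.
-- With the colouring/orientation rule of the paper, the code of a_s b_t
-- w.r.t. a_s is exactly that factor index (as an element of Code m n).

IsOneFactorization : (m n : ℕ) → (Fin (m + (n + n)) → Fin (m + (n + n)) → Code m n) → Set
IsOneFactorization m n f =
  (∀ i s → ∃! _≡_ (λ t → f s t ≡ i)) ×
  (∀ i t → ∃! _≡_ (λ s → f s t ≡ i))

-- The family Z_{m,n,q}.
-- A vertex (i; v_1,…,v_q): v_j = nothing encodes the placeholder "·",
-- required exactly at position i.

wfZ : (k q : ℕ) → Fin q → Vec (Maybe (Fin k)) q → Bool
wfZ k q i v = and (map (λ j → ⌊ ⌊ j ≟ i ⌋ ≟ᵇ is-nothing (lookup v j) ⌋) (allFin q))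

record ZVertex (k q : ℕ) : Set where
  constructor zv
  field
    index  : Fin q
    coords : Vec (Maybe (Fin k)) q
    valid  : T (wfZ k q index coords)

-- code of vw w.r.t. v in Z built from H (given by f)
zAdj : (m n q : ℕ) → (Fin (m + (n + n)) → Fin (m + (n + n)) → Code m n) →
       ZVertex (m + (n + n)) q → ZVertex (m + (n + n)) q → Maybe (Code m n)
zAdj m n q f (zv i v _) (zv j w _) with i <? j | j <? i
... | yes _ | _ =
        lookup v j >>= λ s → lookup w i >>= λ t → just (f s t)
... | no _ | yes _ =
        lookup w i >>= λ s → lookup v j >>= λ t → just (rev m n (f s t))
... | no _ | no _ = nothing

{-# OPTIONS --safe #-}
module Submission where

-- A clique of size at most q − 1 has pairwise distinct indices (vertices of equal
-- index are nonadjacent), so some index k is unused.  We build x of index k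
-- coordinate by coordinate: the code of x X_i depends only on the coordinate of x
-- at the index of X_i and the coordinate of X_i at k, and because H comes from a
-- 1-factorization, for each fixed coordinate of X_i every code is attained by a
-- suitable choice of the coordinate of x.  The remaining coordinates are arbitrary
-- symbols, which exist since m + 2n ≥ 1.

open import Defs
open import Data.Nat using (ℕ; suc; _+_; _∸_; _≤_; _<_; s≤s)
open import Data.Fin using (Fin; zero; _≟_; _<?_; splitAt; join; fromℕ<)
  renaming (_<_ to _<ᶠ_)
open import Data.Fin.Properties
  using (all?; any?; ¬∀⟶∃¬; <⇒notInjective; splitAt-join; join-splitAt; <-cmp; <-irrefl; <-asym)
open import Data.Sum using (_⊎_; inj₁; inj₂; swap; map₂)
open import Data.Sum.Properties using (swap-involutive)
open import Data.Maybe using (Maybe; just; nothing; is-just; is-nothing; _>>=_)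
open import Data.Bool using (T)
open import Data.Bool.Properties using () renaming (_≟_ to _≟ᵇ_)
open import Data.Vec using (Vec; lookup; tabulate)
open import Data.Vec.Properties using (lookup∘tabulate)
open import Data.List.Relation.Unary.All.Properties using (all⁺; all⁻; tabulate⁺; tabulate⁻)
open import Data.Product using (∃; _,_; proj₁; proj₂)
open import Data.Empty using (⊥-elim)
open import Function using (_∘_)
open import Function.Definitions using (Injective)
open import Relation.Binary.PropositionalEquality
open import Relation.Binary.Definitions using (tri<; tri≈; tri>)
open import Relation.Nullary using (yes; no; contradiction)
open import Relation.Nullary.Decidable using (⌊_⌋)

swap-blocks : ∀ k l → Fin (k + l) → Fin (l + k)
swap-blocks k l = join l k ∘ swap ∘ splitAt k

swap-blocks-involutive : ∀ k l (x : Fin (k + l)) → swap-blocks l k (swap-blocks k l x) ≡ x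
swap-blocks-involutive k l x = begin
  join k l (swap (splitAt l (join l k (swap (splitAt k x)))))
    ≡⟨ cong (join k l ∘ swap) (splitAt-join l k (swap (splitAt k x))) ⟩
  join k l (swap (swap (splitAt k x)))
    ≡⟨ cong (join k l) (swap-involutive (splitAt k x)) ⟩
  join k l (splitAt k x)
    ≡⟨ join-splitAt k l x ⟩
  x ∎
  where open ≡-Reasoning

module _ (m n : ℕ) where

  private
    swap-arcs : Fin m ⊎ Fin (n + n) → Fin m ⊎ Fin (n + n)
    swap-arcs = map₂ (swap-blocks n n)

    swap-arcs-involutive : ∀ s → swap-arcs (swap-arcs s) ≡ s
    swap-arcs-involutive (inj₁ _) = refl
    swap-arcs-involutive (inj₂ d) = cong inj₂ (swap-blocks-involutive n n d)

    rev-≡-swap-arcs : ∀ c → rev m n c ≡ join m (n + n) (swap-arcs (splitAt m c))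
    rev-≡-swap-arcs c with splitAt m c
    ... | inj₁ _ = refl
    ... | inj₂ d with splitAt n d
    ...   | inj₁ _ = refl
    ...   | inj₂ _ = refl

  rev-involutive : ∀ c → rev m n (rev m n c) ≡ c
  rev-involutive c = begin
    rev m n (rev m n c)
      ≡⟨ rev-≡-swap-arcs (rev m n c) ⟩
    join m (n + n) (swap-arcs (splitAt m (rev m n c)))
      ≡⟨ cong (join m (n + n) ∘ swap-arcs ∘ splitAt m) (rev-≡-swap-arcs c) ⟩
    join m (n + n) (swap-arcs (splitAt m (join m (n + n) (swap-arcs (splitAt m c)))))
      ≡⟨ cong (join m (n + n) ∘ swap-arcs) (splitAt-join m (n + n) (swap-arcs (splitAt m c))) ⟩
    join m (n + n) (swap-arcs (swap-arcs (splitAt m c)))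
      ≡⟨ cong (join m (n + n)) (swap-arcs-involutive (splitAt m c)) ⟩
    join m (n + n) (splitAt m c)
      ≡⟨ join-splitAt m (n + n) c ⟩
    c ∎
    where open ≡-Reasoning

∃-∉-image : ∀ {ℓ q} (g : Fin ℓ → Fin q) → ℓ < q → ∃ λ k → ∀ i → g i ≢ k
∃-∉-image {ℓ} {q} g ℓ<q with all? (λ k → any? (λ i → g i ≟ k))
... | yes surjective = ⊥-elim (<⇒notInjective ℓ<q section-injective)
  where
  section-injective : Injective _≡_ _≡_ (proj₁ ∘ surjective)
  section-injective {a} {b} e =
    trans (sym (proj₂ (surjective a))) (trans (cong g e) (proj₂ (surjective b)))
... | no ¬surjective with ¬∀⟶∃¬ q _ (λ k → any? (λ i → g i ≟ k)) ¬surjective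
...   | k , ¬hit = k , λ i e → ¬hit (i , e)

injective⇒∃-extension : ∀ {ℓ q} {A : Set} {g : Fin ℓ → Fin q} → Injective _≡_ _≡_ g →
  (s : Fin ℓ → A) → A → ∃ λ (h : Fin q → A) → ∀ i → h (g i) ≡ s i
injective⇒∃-extension {q = q} {A = A} {g = g} g-inj s default = h , h∘g≡s
  where
  h : Fin q → A
  h j with any? (λ i → g i ≟ j)
  ... | yes (i , _) = s i
  ... | no _ = default
  h∘g≡s : ∀ i → h (g i) ≡ s i
  h∘g≡s i with any? (λ i′ → g i′ ≟ g i)
  ... | yes (i′ , e) = cong s (g-inj e)
  ... | no ¬hit = ⊥-elim (¬hit (i , refl))

module _ {K q : ℕ} where

  open ZVertex

  PlaceholderExactlyAt : Fin q → Vec (Maybe (Fin K)) q → Fin q → Set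
  PlaceholderExactlyAt i v j = T ⌊ ⌊ j ≟ i ⌋ ≟ᵇ is-nothing (lookup v j) ⌋

  wfZ-intro : ∀ i (v : Vec (Maybe (Fin K)) q) → (∀ j → PlaceholderExactlyAt i v j) → T (wfZ K q i v)
  wfZ-intro i v valid-at = all⁻ _ (tabulate⁺ valid-at)

  wfZ-elim : ∀ i (v : Vec (Maybe (Fin K)) q) → T (wfZ K q i v) → ∀ j → PlaceholderExactlyAt i v j
  wfZ-elim i v valid = tabulate⁻ (all⁺ _ _ valid)

  lookup-coords-≢-index : ∀ (v : ZVertex K q) {j} → j ≢ index v → ∃ λ t → lookup (coords v) j ≡ just t
  lookup-coords-≢-index v {j} j≢i with wfZ-elim (index v) (coords v) (valid v) j
  ... | valid-at with j ≟ index v | lookup (coords v) j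
  ...   | yes j≡i | _      = ⊥-elim (j≢i j≡i)
  ...   | no _    | just t = t , refl
  ...   | no _    | nothing = ⊥-elim valid-at

  placeholderAt : Fin q → (Fin q → Fin K) → Fin q → Maybe (Fin K)
  placeholderAt i g j with j ≟ i
  ... | yes _ = nothing
  ... | no _  = just (g j)

  zvertexFrom : Fin q → (Fin q → Fin K) → ZVertex K q
  zvertexFrom i g = zv i (tabulate (placeholderAt i g)) (wfZ-intro i (tabulate (placeholderAt i g)) valid-at)
    where
    valid-at : ∀ j → PlaceholderExactlyAt i (tabulate (placeholderAt i g)) j
    valid-at j rewrite lookup∘tabulate (placeholderAt i g) j with j ≟ i
    ... | yes _ = _
    ... | no _  = _

  lookup-zvertexFrom : ∀ i g {j} → j ≢ i → lookup (coords (zvertexFrom i g)) j ≡ just (g j)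
  lookup-zvertexFrom i g {j} j≢i rewrite lookup∘tabulate (placeholderAt i g) j with j ≟ i
  ... | yes j≡i = ⊥-elim (j≢i j≡i)
  ... | no _    = refl

module _ (m n q : ℕ) (f : Fin (m + (n + n)) → Fin (m + (n + n)) → Code m n) where

  open ZVertex

  private
    V : Set
    V = ZVertex (m + (n + n)) q
    adj : V → V → Maybe (Code m n)
    adj = zAdj m n q f

  zAdj-sameIndex : ∀ (x y : V) → index x ≡ index y → adj x y ≡ nothing
  zAdj-sameIndex (zv i _ _) (zv .i _ _) refl with i <? i
  ... | yes i<i = ⊥-elim (<-irrefl refl i<i)
  ... | no _    = refl

  zAdj-< : ∀ (x y : V) → index x <ᶠ index y →
    adj x y ≡ (lookup (coords x) (index y) >>= λ s → lookup (coords y) (index x) >>= λ t → just (f s t))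
  zAdj-< (zv i _ _) (zv j _ _) i<j with i <? j
  ... | yes _  = refl
  ... | no i≮j = contradiction i<j i≮j

  zAdj-> : ∀ (x y : V) → index y <ᶠ index x →
    adj x y ≡ (lookup (coords y) (index x) >>= λ s → lookup (coords x) (index y) >>= λ t → just (rev m n (f s t)))
  zAdj-> (zv i _ _) (zv j _ _) j<i with i <? j | j <? i
  ... | yes i<j | _      = ⊥-elim (<-asym i<j j<i)
  ... | no _    | yes _  = refl
  ... | no _    | no j≮i = contradiction j<i j≮i

  clique-index-injective : ∀ {ℓ} {X : Fin ℓ → V} → IsClique m n adj X → Injective _≡_ _≡_ (index ∘ X)
  clique-index-injective {X = X} (_ , adjacent) {i} {i′} same-index with i ≟ i′
  ... | yes i≡i′ = i≡i′
  ... | no i≢i′  = ⊥-elim (subst (T ∘ is-just) (zAdj-sameIndex (X i) (X i′) same-index) (adjacent i i′ i≢i′))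

  Forces : Fin q → V → Fin (m + (n + n)) → Code m n → Set
  Forces k y s c = ∀ x → index x ≡ k → lookup (coords x) (index y) ≡ just s → adj x y ≡ just c

  module _ (F : IsOneFactorization m n f) where

    row-solution : ∀ c s → ∃ λ t → f s t ≡ c
    row-solution c s = let t , fst≡c , _ = proj₁ F c s in t , fst≡c

    column-solution : ∀ c t → ∃ λ s → f s t ≡ c
    column-solution c t = let s , fst≡c , _ = proj₂ F c t in s , fst≡c

    code-realisable : ∀ (y : V) {k} → k ≢ index y → (c : Code m n) → ∃ λ s → Forces k y s c
    code-realisable y {k} k≢j c with lookup-coords-≢-index y k≢j | <-cmp k (index y)
    ... | _ | tri≈ _ k≡j _ = ⊥-elim (k≢j k≡j)
    ... | t , y[k]≡t | tri< k<j _ _ = s , forces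
      where
      s : Fin (m + (n + n))
      s = proj₁ (column-solution c t)
      forces : Forces k y s c
      forces x refl x[j]≡s rewrite zAdj-< x y k<j | x[j]≡s | y[k]≡t = cong just (proj₂ (column-solution c t))
    ... | s , y[k]≡s | tri> _ _ j<k = t , forces
      where
      t : Fin (m + (n + n))
      t = proj₁ (row-solution (rev m n c) s)
      forces : Forces k y t c
      forces x refl x[j]≡t rewrite zAdj-> x y j<k | x[j]≡t | y[k]≡s =
        cong just (trans (cong (rev m n) (proj₂ (row-solution (rev m n c) s))) (rev-involutive m n c))

proposition1 : (m n : ℕ) → 1 ≤ m + (n + n) → (q : ℕ) → 2 ≤ q →
    (f : Fin (m + (n + n)) → Fin (m + (n + n)) → Code m n) →
    IsOneFactorization m n f →
    Property-P m n (ZVertex (m + (n + n)) q) (zAdj m n q f) (q ∸ 1) 1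
proposition1 m n codes≥1 (suc q) _ f F ℓ ℓ≤q X clique L =
  (λ _ → x) , (λ { {zero} {zero} _ → refl }) , λ _ → x∉X , x-realises-L
  where
  open ZVertex
  unused : ∃ λ k → ∀ i → index (X i) ≢ k
  unused = ∃-∉-image (index ∘ X) (s≤s ℓ≤q)
  k : Fin (suc q)
  k = proj₁ unused
  k≢index : ∀ i → k ≢ index (X i)
  k≢index i = proj₂ unused i ∘ sym
  realisable : ∀ i → ∃ λ s → Forces m n (suc q) f k (X i) s (L i)
  realisable i = code-realisable m n (suc q) f F (X i) (k≢index i) (L i)
  extension : ∃ λ g → ∀ i → g (index (X i)) ≡ proj₁ (realisable i)
  extension = injective⇒∃-extension (clique-index-injective m n (suc q) f clique)
                (proj₁ ∘ realisable) (fromℕ< codes≥1)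
  x : ZVertex (m + (n + n)) (suc q)
  x = zvertexFrom k (proj₁ extension)
  x∉X : ∀ i → x ≢ X i
  x∉X i x≡Xi = k≢index i (cong index x≡Xi)
  x-realises-L : ∀ i → zAdj m n (suc q) f x (X i) ≡ just (L i)
  x-realises-L i = proj₂ (realisable i) x refl
    (trans (lookup-zvertexFrom k (proj₁ extension) (proj₂ unused i)) (cong just (proj₂ extension i)))
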